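{- Let $T$ be a layered working-set tree (as defined in the context) with layers $L_1,\dots,L_t$. Then every node $x\in L_j$ has depth $O(2^j)$ in $T$.
   Context: A layered working-set tree is a binary search tree $T$ in which each node $x$ carries a label $\mathrm{layer}(x)\in\{1,\dots,t\}$ such that no node has an ancestor with a label greater than its own label. The nodes with label $j$ form the layer $L_j$; for $j<t$, $|L_j|=2^{2^j}$, and $L_t$ contains the remaining nodes (so $|L_t|\le 2^{2^t}$). A layer-subtree is a maximal connected subtree of $T$ all of whose nodes lie in the same layer. Each layer-subtree is maintained independently as a red-black tree (balance criteria applied only to the nodes within that layer-subtree), so that every node of a layer-subtree $T'$ has depth within $T'$ at most $O(\lg |T'|)$. Here $\lg x=\log_2(x+2)$. -}

module Defs where

open import Data.Nat using (ℕ; zero; suc; _+_; _*_; _^_; _≤_; _<_; _≟_)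
open import Data.Nat.Logarithm using (⌈log₂_⌉)
open import Data.List using (List; []; _∷_; _++_; length)
open import Data.List.Relation.Unary.All using (All)
open import Data.Maybe using (Maybe; just; nothing)
open import Data.Product using (_×_; ∃; ∃₂; _,_)
open import Data.Sum using (_⊎_)
open import Data.Unit using (⊤)
open import Relation.Nullary using (yes; no; ¬_)
open import Relation.Binary.PropositionalEquality using (_≡_)

lg : ℕ → ℕ
lg x = ⌈log₂ (x + 2) ⌉

-- Binary trees whose nodes carry a key and a layer label:
-- node left key layer right
data Tree : Set where
  leaf : Tree
  node : Tree → ℕ → ℕ → Tree → Tree

keys : Tree → List ℕ
keys leaf = []
keys (node l k _ r) = keys l ++ (k ∷ keys r)

IsBST : Tree → Set
IsBST leaf = ⊤
IsBST (node l k _ r) = All (_< k) (keys l) × All (k <_) (keys r) × IsBST l × IsBST r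

-- positions of nodes: paths from the root
data Dir : Set where
  L R : Dir

Path : Set
Path = List Dir

sub : Tree → Path → Tree
sub t [] = t
sub leaf (_ ∷ _) = leaf
sub (node l _ _ r) (L ∷ p) = sub l p
sub (node l _ _ r) (R ∷ p) = sub r p

layerAt : Tree → Path → Maybe ℕ
layerAt t p with sub t p
... | leaf = nothing
... | node _ _ j _ = just j

-- a path p is a node of t (its depth in t is length p)
IsNode : Tree → Path → Set
IsNode t p = ∃ λ j → layerAt t p ≡ just j

size : Tree → ℕ
size leaf = 0
size (node l _ _ r) = suc (size l + size r)

layerCount : ℕ → Tree → ℕ
layerCount j leaf = 0
layerCount j (node l _ i r) with i ≟ j
... | yes _ = suc (layerCount j l + layerCount j r)
... | no _ = layerCount j l + layerCount j r

restrict : ℕ → Tree → Tree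
restrict j leaf = leaf
restrict j (node l k i r) with i ≟ j
... | yes _ = node (restrict j l) k i (restrict j r)
... | no _ = leaf

IsLayerRoot : Tree → Path → ℕ → Set
IsLayerRoot t p j =
  layerAt t p ≡ just j ×
  (p ≡ [] ⊎ ∃₂ λ p' d → p ≡ p' ++ (d ∷ []) × ¬ (layerAt t p' ≡ just j))

layerSubtree : Tree → Path → ℕ → Tree
layerSubtree t p j = restrict j (sub t p)

-- Layered working-set tree with t layers, whose layer-subtrees satisfy
-- the (red-black) balance guarantee with constant c: every node of a
-- layer-subtree T' has depth within T' at most c * lg |T'|.
record LayeredWST (c : ℕ) (T : Tree) (t : ℕ) : Set where
  field
    bst       : IsBST T
    labels    : ∀ p j → layerAt T p ≡ just j → 1 ≤ j × j ≤ t
    ancestors : ∀ p q i j → layerAt T p ≡ just i → layerAt T (p ++ q) ≡ just j → i ≤ j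
    sizes     : ∀ j → 1 ≤ j → j < t → layerCount j T ≡ 2 ^ (2 ^ j)
    sizeLast  : layerCount t T ≤ 2 ^ (2 ^ t)
    balanced  : ∀ p j q → IsLayerRoot T p j → IsNode (layerSubtree T p j) q →
                length q ≤ c * lg (size (layerSubtree T p j))

module Submission where

-- Follow the root-to-node path p of a node x in layer j.  Either every node
-- on p lies in layer j, so p runs inside the layer-subtree at the root of T,
-- or p = p₀ ++ d ∷ q where p₀ is the last node outside layer j (its layer i
-- is < j by the ancestor condition) and q runs inside the layer-subtree
-- rooted at p₀ ++ [d].  A layer-j subtree has at most |L_j| ≤ 2^(2^j) nodes,
-- so by balance such a run has at most c·(2^j + 1) + 1 nodes.  Strong
-- induction on j then gives the invariant  (|p| + 1) + K ≤ K·2^j.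

open import Defs
open import Data.Nat using (ℕ; zero; suc; _+_; _*_; _^_; _≤_; _<_; _≟_; z≤n; s≤s)
open import Data.Nat.Properties
open import Data.Nat.Induction using (<-rec)
open import Data.Nat.Logarithm using (⌈log₂_⌉; ⌈log₂⌉-mono-≤; ⌈log₂2^n⌉≡n)
open import Data.Nat.Tactic.RingSolver using (solve-∀)
open import Data.List using ([]; _∷_; _++_; length)
open import Data.List.Properties using (length-++)
open import Data.Maybe using (Maybe; just; nothing)
open import Data.Maybe.Properties using (just-injective)
open import Data.Product using (∃; _,_; _×_; proj₁; proj₂)
open import Data.Sum using (inj₁; inj₂)
open import Data.Empty using (⊥-elim)
open import Relation.Nullary using (yes; no; ¬_)
open import Relation.Binary.PropositionalEquality

rootLayer : Tree → Maybe ℕ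
rootLayer leaf = nothing
rootLayer (node _ _ j _) = just j

layerAt-sub : ∀ t p → layerAt t p ≡ rootLayer (sub t p)
layerAt-sub t p with sub t p
... | leaf = refl
... | node _ _ _ _ = refl

sub-leaf : ∀ p → sub leaf p ≡ leaf
sub-leaf [] = refl
sub-leaf (_ ∷ _) = refl

sub-++ : ∀ t p q → sub t (p ++ q) ≡ sub (sub t p) q
sub-++ t [] q = refl
sub-++ leaf (_ ∷ p) q = sym (sub-leaf q)
sub-++ (node l _ _ r) (L ∷ p) q = sub-++ l p q
sub-++ (node l _ _ r) (R ∷ p) q = sub-++ r p q

Run : Tree → ℕ → Path → Set
Run t j [] = rootLayer t ≡ just j
Run t j (d ∷ q) = rootLayer t ≡ just j × Run (sub t (d ∷ [])) j q

run-root : ∀ t j q → Run t j q → rootLayer t ≡ just j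
run-root t j [] run = run
run-root t j (d ∷ q) run = proj₁ run

run-restrict : ∀ j t q → Run t j q → rootLayer (sub (restrict j t) q) ≡ just j
run-restrict j leaf q run with () ← run-root leaf j q run
run-restrict j (node l k i r) q run with i ≟ j
... | no i≢j = ⊥-elim (i≢j (just-injective (run-root _ j q run)))
run-restrict j (node l k i r) [] run | yes refl = refl
run-restrict j (node l k i r) (L ∷ q) run | yes refl = run-restrict j l q (proj₂ run)
run-restrict j (node l k i r) (R ∷ q) run | yes refl = run-restrict j r q (proj₂ run)

data LastChange (t : Tree) (j : ℕ) : Path → Set where
  run-from-root : ∀ {p} → Run t j p → LastChange t j p
  change-at : ∀ p₀ d q i → rootLayer (sub t p₀) ≡ just i → ¬ i ≡ j →
              Run (sub t (p₀ ++ d ∷ [])) j q → LastChange t j (p₀ ++ d ∷ q)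

extend : ∀ l k i r d j p → LastChange (sub (node l k i r) (d ∷ [])) j p →
         LastChange (node l k i r) j (d ∷ p)
extend l k i r L j _ (change-at p₀ d q i′ e i′≢j run) = change-at (L ∷ p₀) d q i′ e i′≢j run
extend l k i r R j _ (change-at p₀ d q i′ e i′≢j run) = change-at (R ∷ p₀) d q i′ e i′≢j run
extend l k i r d j p (run-from-root run) with i ≟ j
... | yes refl = run-from-root (refl , run)
... | no i≢j = change-at [] d p i refl i≢j run

lastChange : ∀ t j p → rootLayer (sub t p) ≡ just j → LastChange t j p
lastChange leaf j [] ()
lastChange leaf j (_ ∷ _) ()
lastChange (node l k i r) j [] e = run-from-root e
lastChange (node l k i r) j (L ∷ p) e = extend l k i r L j p (lastChange l j p e)
lastChange (node l k i r) j (R ∷ p) e = extend l k i r R j p (lastChange r j p e)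

-- the layer-j part around the root consists of layer-j nodes only
restrict-size : ∀ j t → size (restrict j t) ≤ layerCount j t
restrict-size j leaf = z≤n
restrict-size j (node l k i r) with i ≟ j
... | yes _ = s≤s (+-mono-≤ (restrict-size j l) (restrict-size j r))
... | no _ = z≤n

layerCount-left : ∀ j l k i r → layerCount j l ≤ layerCount j (node l k i r)
layerCount-left j l k i r with i ≟ j
... | yes _ = m≤n⇒m≤1+n (m≤m+n _ _)
... | no _ = m≤m+n _ _

layerCount-right : ∀ j l k i r → layerCount j r ≤ layerCount j (node l k i r)
layerCount-right j l k i r with i ≟ j
... | yes _ = m≤n⇒m≤1+n (m≤n+m _ _)
... | no _ = m≤n+m _ _

layerCount-sub : ∀ j t p → layerCount j (sub t p) ≤ layerCount j t
layerCount-sub j t [] = ≤-refl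
layerCount-sub j leaf (_ ∷ _) = z≤n
layerCount-sub j (node l k i r) (L ∷ p) = ≤-trans (layerCount-sub j l p) (layerCount-left j l k i r)
layerCount-sub j (node l k i r) (R ∷ p) = ≤-trans (layerCount-sub j r p) (layerCount-right j l k i r)

lg-≤ : ∀ x k → 1 ≤ k → x ≤ 2 ^ k → lg x ≤ suc k
lg-≤ x (suc k) _ x≤2^k = begin
  ⌈log₂ (x + 2) ⌉          ≤⟨ ⌈log₂⌉-mono-≤ x+2≤2^[k+2] ⟩
  ⌈log₂ (2 ^ suc (suc k)) ⌉ ≡⟨ ⌈log₂2^n⌉≡n (suc (suc k)) ⟩
  suc (suc k)              ∎
  where
  open ≤-Reasoning
  -- 2 ≤ 2^(k+1), so x + 2 ≤ 2^(k+1) + 2^(k+1)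
  x+2≤2^[k+2] : x + 2 ≤ 2 ^ suc (suc k)
  x+2≤2^[k+2] = ≤-trans (+-mono-≤ x≤2^k (*-monoʳ-≤ 2 (m^n>0 2 k)))
                  (≤-reflexive (cong (2 ^ suc k +_) (sym (+-identityʳ (2 ^ suc k)))))

scale : ℕ → ℕ
scale c = suc (3 * c)

-- number of nodes on a root-to-node path inside a balanced layer-j subtree
runCap : ℕ → ℕ → ℕ
runCap c j = suc (c * suc (2 ^ j))

-- runCap c (j + 1) ≤ scale c · 2^j, written for an arbitrary X = 2^j ≥ 1
runCap-≤ : ∀ c X → 1 ≤ X → suc (c * suc (2 * X)) ≤ scale c * X
runCap-≤ c (suc Y) _ = ≤-trans (m≤m+n _ (Y + c * Y)) (≤-reflexive (sym (expand c Y)))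
  where
  expand : ∀ c Y → suc (3 * c) * suc Y ≡ suc (c * suc (2 * suc Y)) + (Y + c * Y)
  expand = solve-∀

-- the induction step: a prefix with weight a within budget for layer j,
-- followed by a run of b nodes in layer j + 1, stays within budget for j + 1
depth-step : ∀ c j a b → a + scale c ≤ scale c * 2 ^ j → b ≤ runCap c (suc j) →
             a + b + scale c ≤ scale c * 2 ^ suc j
depth-step c j a b prefix run = begin
  a + b + scale c                 ≡⟨ swap a b (scale c) ⟩
  (a + scale c) + b               ≤⟨ +-mono-≤ prefix (≤-trans run (runCap-≤ c (2 ^ j) (m^n>0 2 j))) ⟩
  scale c * 2 ^ j + scale c * 2 ^ j ≡⟨ sym (double (scale c) (2 ^ j)) ⟩
  scale c * 2 ^ suc j             ∎
  where
  open ≤-Reasoning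
  swap : ∀ a b k → a + b + k ≡ (a + k) + b
  swap = solve-∀
  double : ∀ k X → k * (2 * X) ≡ k * X + k * X
  double = solve-∀

module InLayeredTree (c : ℕ) (T : Tree) (t : ℕ) (W : LayeredWST c T t) where
  open LayeredWST W

  layerSubtree-size : ∀ r j → 1 ≤ j → j ≤ t → size (layerSubtree T r j) ≤ 2 ^ 2 ^ j
  layerSubtree-size r j 1≤j j≤t =
    ≤-trans (restrict-size j (sub T r)) (≤-trans (layerCount-sub j T r) layer-j-size)
    where
    layer-j-size : layerCount j T ≤ 2 ^ 2 ^ j
    layer-j-size with m≤n⇒m<n∨m≡n j≤t
    ... | inj₁ j<t = ≤-reflexive (sizes j 1≤j j<t)
    ... | inj₂ refl = sizeLast

  run-length : ∀ r j q → IsLayerRoot T r j → Run (sub T r) j q → suc (length q) ≤ runCap c j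
  run-length r j q root run = s≤s (begin
    length q                               ≤⟨ balanced r j q root q-is-node ⟩
    c * lg (size (layerSubtree T r j))      ≤⟨ *-monoʳ-≤ c (lg-≤ _ (2 ^ j) (m^n>0 2 j) size-bound) ⟩
    c * suc (2 ^ j)                         ∎)
    where
    open ≤-Reasoning
    q-is-node : IsNode (layerSubtree T r j) q
    q-is-node = j , trans (layerAt-sub _ q) (run-restrict j (sub T r) q run)
    size-bound : size (layerSubtree T r j) ≤ 2 ^ 2 ^ j
    size-bound = layerSubtree-size r j (proj₁ (labels r j (proj₁ root))) (proj₂ (labels r j (proj₁ root)))

  DepthBound : ℕ → Set
  DepthBound j = ∀ p → layerAt T p ≡ just j → suc (length p) + scale c ≤ scale c * 2 ^ j

  depth-bound : ∀ j → DepthBound j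
  depth-bound = <-rec DepthBound step
    where
    step : ∀ j → (∀ {i} → i < j → DepthBound i) → DepthBound j
    step zero _ p e with () ← proj₁ (labels p zero e)
    step (suc j) ih p e with lastChange T (suc j) p (trans (sym (layerAt-sub T p)) e)
    ... | run-from-root run =
      depth-step c j 0 (suc (length p)) scale≤ (run-length [] (suc j) p root run)
      where
      root : IsLayerRoot T [] (suc j)
      root = trans (layerAt-sub T []) (run-root T (suc j) p run) , inj₁ refl
      scale≤ : scale c ≤ scale c * 2 ^ j
      scale≤ = ≤-trans (≤-reflexive (sym (*-identityʳ (scale c)))) (*-monoʳ-≤ (scale c) (m^n>0 2 j))
    ... | change-at p₀ d q i e₀ i≢j run = begin
      suc (length (p₀ ++ d ∷ q)) + scale c       ≡⟨ cong (λ n → suc n + scale c) (length-++ p₀) ⟩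
      suc (length p₀) + suc (length q) + scale c ≤⟨ depth-step c j (suc (length p₀)) (suc (length q)) prefix (run-length r (suc j) q root run) ⟩
      scale c * 2 ^ suc j                        ∎
      where
      open ≤-Reasoning
      r = p₀ ++ d ∷ []
      layer-p₀ : layerAt T p₀ ≡ just i
      layer-p₀ = trans (layerAt-sub T p₀) e₀
      i<j+1 : i < suc j
      i<j+1 = ≤∧≢⇒< (ancestors p₀ (d ∷ q) i (suc j) layer-p₀ e) i≢j
      prefix : suc (length p₀) + scale c ≤ scale c * 2 ^ j
      prefix = ≤-trans (ih i<j+1 p₀ layer-p₀) (*-monoʳ-≤ (scale c) (^-monoʳ-≤ 2 (≤-pred i<j+1)))
      root : IsLayerRoot T r (suc j)
      root = trans (layerAt-sub T r) (run-root _ (suc j) q run)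
           , inj₂ (p₀ , d , refl , λ e′ → i≢j (just-injective (trans (sym layer-p₀) e′)))

lemma1 : ∀ (c : ℕ) → ∃ λ (C : ℕ) → ∀ (T : Tree) (t : ℕ) → LayeredWST c T t →
           ∀ p j → layerAt T p ≡ just j → length p ≤ C * 2 ^ j
lemma1 c = scale c , λ T t W p j e →
  ≤-trans (≤-trans (n≤1+n (length p)) (m≤m+n _ (scale c)))
          (InLayeredTree.depth-bound c T t W j p e)
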